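{- For every $1\le\alpha<2$ and every $n$, the Adaptive Exploration Algorithm achieves a competitive ratio of (at most) $\frac{\alpha+1}{2}$ on GEEWE instances whose graph is the complete graph $K_n$ with distinct start and end vertices and all edges announced with the interval $[1,\alpha]$.
   Context: Graph Exploration with Edge Weight Estimates (GEEWE): An instance consists of a connected graph $G=(V,E)$, for every edge $e$ a lower bound $\ell(e)$ and an upper bound $u(e)$, a start vertex $s$ and a distinct end vertex $t$, and actual weights $w(e)\in[\ell(e),u(e)]$. The graph and bounds are known in advance; $w(e)$ is revealed as soon as the agent visits a vertex incident to $e$. The agent, starting at $s$, must perform a walk (repetitions allowed) from $s$ to $t$ visiting all vertices; its cost is the sum of actual weights of traversed edges with multiplicity; $\mathrm{OPT}$ is the minimum such cost with all weights known. Competitive ratio at most $c$ means cost $\le c\cdot\mathrm{OPT}$ on every instance of the class. Adaptive Exploration Algorithm: while not all vertices have been visited, compute a shortest walk from the current vertex to $t$ visiting all unvisited vertices, using actual weights for revealed edges and upper bounds $u(e)$ for unrevealed ones, and move to the next vertex on that walk.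
   Formalization: The bound α and the actual weights $w(e)$ are rational. -}

module Defs where

open import Data.Nat using (ℕ)
open import Data.Fin using (Fin; _≟_)
open import Data.Bool using (Bool; if_then_else_; _∨_)
open import Data.List using (List; []; _∷_; _∷ʳ_; head; last)
open import Data.Bool.ListAction using (any)
open import Data.List.Membership.Propositional using (_∈_; _∉_)
open import Data.List.Relation.Unary.Linked using (Linked)
open import Data.Maybe using (just)
open import Data.Product using (_×_)
open import Data.Rational using (ℚ; 0ℚ; _+_; _≤_)
open import Relation.Binary.PropositionalEquality using (_≡_; _≢_)
open import Relation.Nullary using (¬_)
open import Relation.Nullary.Decidable using (⌊_⌋)

cost : {n : ℕ} → (Fin n → Fin n → ℚ) → List (Fin n) → ℚ
cost c []            = 0ℚ
cost c (x ∷ [])      = 0ℚ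
cost c (x ∷ y ∷ xs)  = c x y + cost c (y ∷ xs)

-- A walk in the complete graph K_n: a nonempty vertex list whose
-- consecutive vertices are distinct (i.e. joined by an edge of K_n).
IsWalkFromTo : {n : ℕ} → Fin n → Fin n → List (Fin n) → Set
IsWalkFromTo a b W = head W ≡ just a × last W ≡ just b × Linked _≢_ W

-- A GEEWE instance on K_n: bound α (all edges announced with [1, α]),
-- start s, end t, actual weights w (symmetric, w i j for edge {i,j}).
module GEEWE {n : ℕ} (α : ℚ) (s t : Fin n) (w : Fin n → Fin n → ℚ) where

  IsExplorationWalk : List (Fin n) → Set
  IsExplorationWalk W = IsWalkFromTo s t W × (∀ u → u ∈ W)

  visited? : List (Fin n) → Fin n → Bool
  visited? h v = any (λ x → ⌊ x ≟ v ⌋) h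

  -- the agent's knowledge after history h: the actual weight of revealed
  -- edges (incident to a visited vertex), the upper bound α otherwise
  estimate : List (Fin n) → Fin n → Fin n → ℚ
  estimate h i j = if visited? h i ∨ visited? h j then w i j else α

  Finished : Fin n → List (Fin n) → Set
  Finished v h = (∀ u → u ∈ h) × v ≡ t

  IsPlan : List (Fin n) → Fin n → List (Fin n) → Set
  IsPlan h v P = IsWalkFromTo v t P × (∀ u → u ∉ h → u ∈ P)

  IsShortestPlan : List (Fin n) → Fin n → List (Fin n) → Set
  IsShortestPlan h v P =
    IsPlan h v P × (∀ Q → IsPlan h v Q → cost (estimate h) P ≤ cost (estimate h) Q)

  -- Run v h : h (in order) is the walk performed so far by some execution
  -- of the Adaptive Exploration Algorithm (any tie-breaking), v its
  -- current vertex.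
  data Run : Fin n → List (Fin n) → Set where
    start : Run s (s ∷ [])
    step  : ∀ {v h} → Run v h → ¬ Finished v h →
            (x : Fin n) (rest : List (Fin n)) →
            IsShortestPlan h v (v ∷ x ∷ rest) →
            Run x (h ∷ʳ x)

module Submission where

-- Since every weight lies in [1, α] and α < 2, a detour through a visited vertex costs more
-- than a direct edge. A shortest plan from v therefore spends about α on every unvisited
-- vertex it still has to enter, and comparing it with the plan "v, y, then the other
-- unvisited vertices, then t" shows that the algorithm always moves to a nearest unvisited
-- vertex other than t, and to t only when nothing else is left.
--
-- Compare the run with any exploration walk W. A vertex x that the run has left, along an
-- edge of weight ℓ(x), is charged 2 at a step of W leaving x, and either 2(ℓ(x) - 1) at a
-- step of W between x and a vertex y still unvisited (and not t) when x was left, so that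
-- ℓ(x) ≤ w(x, y), or α - 1 at a step leaving x and α - 1 at a step entering x (for the start
-- vertex, a step leaving t). This covers 2ℓ(x), while a step of W of weight c receives at
-- most 2 + 2(c - 1) + (α - 1) ≤ (α + 1) c. Hence 2 · cost ≤ (α + 1) · cost W.

open import Defs
open import Algebra.Bundles using (CommutativeMonoid; CommutativeRing)
import Algebra.Definitions.RawMonoid
import Algebra.Properties.Semiring.Sum as Sum
open import Data.Bool using (true; false; if_then_else_; _∨_; _∧_)
open import Data.Empty using (⊥; ⊥-elim)
open import Data.Fin using (Fin; zero; suc; _≟_)
open import Data.List using (List; []; _∷_; _∷ʳ_; _++_; length; last; head; filter; allFin)
open import Data.List.Membership.Propositional using (_∈_; _∉_)
open import Data.List.Membership.Propositional.Properties
  using (∈-∃++; ∈-++⁺ˡ; ∈-++⁺ʳ; ∈-++⁻; ∈-filter⁺; ∈-filter⁻; ∈-allFin)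
open import Data.List.Properties using (length-++; filter-accept)
open import Data.List.Relation.Binary.Infix.Heterogeneous using (Infix; here; there)
open import Data.List.Relation.Binary.Prefix.Heterogeneous using ([]; _∷_)
open import Data.List.Relation.Binary.Subset.Propositional using (_⊆_)
open import Data.List.Relation.Unary.All using ([])
open import Data.List.Relation.Unary.All.Properties using (All¬⇒¬Any; ¬Any⇒All¬)
open import Data.List.Relation.Unary.Any using (here; there)
open import Data.List.Relation.Unary.Linked as Linked using (Linked; []; [-]; _∷_)
open import Data.List.Relation.Unary.Linked.Properties using (AllPairs⇒Linked)
open import Data.List.Relation.Unary.Unique.Propositional using (Unique; []; _∷_)
open import Data.List.Relation.Unary.Unique.Propositional.Properties using (++⁺; filter⁺; allFin⁺)
open import Data.Maybe using (just)
open import Data.Nat using (ℕ; z≤n; s≤s)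
import Data.Nat as ℕ
import Data.Nat.Properties as ℕ
open import Data.Product using (Σ; _×_; _,_; proj₁; proj₂; ∃-syntax; map₂)
open import Data.Rational using (ℚ; 0ℚ; 1ℚ; ½; _+_; _*_; _-_; -_; _≤_; _<_; +-0-rawMonoid; nonNegative)
open import Data.Rational.Properties
  using (≤-refl; ≤-trans; ≤-reflexive; <⇒≤; ≤-<-trans; <-irrefl; positive⁻¹; +-inverseʳ;
         +-mono-<-≤; +-mono-≤; +-monoʳ-≤; +-monoˡ-≤; +-identityˡ; +-identityʳ; +-assoc;
         *-zeroʳ; *-distribˡ-+; *-monoˡ-≤-nonNeg; +-0-commutativeMonoid; +-*-commutativeRing;
         module ≤-Reasoning)
open import Data.Rational.Solver using (module +-*-Solver)
open import Data.Sum using (_⊎_; inj₁; inj₂; [_,_]′)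
import Data.Sum
open import Function using (_∘_)
open import Relation.Binary.PropositionalEquality
  using (_≡_; _≢_; refl; sym; trans; cong; cong₂; subst; module ≡-Reasoning)
open import Relation.Nullary using (¬_; Dec; yes; no; does; contradiction)
open import Relation.Nullary.Decidable using (dec-true; dec-false; _×-dec_; _⊎-dec_; ¬?; toSum)

open Sum (CommutativeRing.semiring +-*-commutativeRing)
  using (sum-syntax; sum-replicate-zero; ∑-distrib-+; *-distribˡ-sum)
open import Algebra.Properties.CommutativeSemigroup
  (CommutativeMonoid.commutativeSemigroup +-0-commutativeMonoid) using (interchange)

private variable
  n : ℕ

2ℚ 3ℚ : ℚ
2ℚ = 1ℚ + 1ℚ
3ℚ = 2ℚ + 1ℚ

0≤1 : 0ℚ ≤ 1ℚ
0≤1 = <⇒≤ (positive⁻¹ 1ℚ)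

0≤2 : 0ℚ ≤ 2ℚ
0≤2 = <⇒≤ (positive⁻¹ 2ℚ)

x≤x+y : ∀ {x y} → 0ℚ ≤ y → x ≤ x + y
x≤x+y {x} 0≤y = ≤-trans (≤-reflexive (sym (+-identityʳ x))) (+-monoʳ-≤ x 0≤y)

*-nonneg : ∀ {a b} → 0ℚ ≤ a → 0ℚ ≤ b → 0ℚ ≤ a * b
*-nonneg {a} 0≤a 0≤b = ≤-trans (≤-reflexive (sym (*-zeroʳ a))) (*-monoˡ-≤-nonNeg a {{nonNegative 0≤a}} 0≤b)

p≤q⇒0≤q-p : ∀ {p q} → p ≤ q → 0ℚ ≤ q - p
p≤q⇒0≤q-p {p} p≤q = ≤-trans (≤-reflexive (sym (+-inverseʳ p))) (+-monoˡ-≤ (- p) p≤q)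

+-cancelʳ-≤ : ∀ {a b} c → a + c ≤ b + c → a ≤ b
+-cancelʳ-≤ {a} {b} c a+c≤b+c = begin
  a             ≡⟨ solve 2 (λ a c → a := (a :+ c) :- c) refl a c ⟩
  (a + c) - c   ≤⟨ +-monoˡ-≤ (- c) a+c≤b+c ⟩
  (b + c) - c   ≡⟨ solve 2 (λ b c → (b :+ c) :- c := b) refl b c ⟩
  b             ∎
  where
  open ≤-Reasoning
  open +-*-Solver

halve : ∀ {a b c} → 2ℚ * a ≤ c * b → a ≤ (c * ½) * b
halve {a} {b} {c} 2a≤cb = begin
  a                ≡⟨ solve 1 (λ a → a := con ½ :* (con 2ℚ :* a)) refl a ⟩
  ½ * (2ℚ * a)     ≤⟨ *-monoˡ-≤-nonNeg ½ 2a≤cb ⟩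
  ½ * (c * b)      ≡⟨ solve 2 (λ b c → con ½ :* (c :* b) := (c :* con ½) :* b) refl b c ⟩
  (c * ½) * b      ∎
  where
  open ≤-Reasoning
  open +-*-Solver

_times_ : ℕ → ℚ → ℚ
_times_ = Algebra.Definitions.RawMonoid._×_ +-0-rawMonoid

times-nonneg : ∀ {a} → 0ℚ ≤ a → ∀ k → 0ℚ ≤ k times a
times-nonneg 0≤a ℕ.zero    = ≤-refl
times-nonneg 0≤a (ℕ.suc k) = +-mono-≤ 0≤a (times-nonneg 0≤a k)

times-monoˡ-≤ : ∀ {a} → 0ℚ ≤ a → ∀ {k m} → k ℕ.≤ m → k times a ≤ m times a
times-monoˡ-≤ 0≤a {m = m} z≤n       = times-nonneg 0≤a m
times-monoˡ-≤ {a} 0≤a (s≤s k≤m) = +-monoʳ-≤ a (times-monoˡ-≤ 0≤a k≤m)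

module _ {A : Set} where

  Step : A → A → List A → Set
  Step x y xs = Infix _≡_ (x ∷ y ∷ []) xs

  ∉-∷ : ∀ {x y : A} {xs} → x ≢ y → x ∉ xs → x ∉ y ∷ xs
  ∉-∷ x≢y _    (here x≡y)   = x≢y x≡y
  ∉-∷ _   x∉xs (there x∈xs) = x∉xs x∈xs

  last-∷ʳ : ∀ (xs : List A) x → last (xs ∷ʳ x) ≡ just x
  last-∷ʳ []           x = refl
  last-∷ʳ (_ ∷ [])     x = refl
  last-∷ʳ (_ ∷ y ∷ xs) x = last-∷ʳ (y ∷ xs) x

  last⇒∈ : ∀ {xs : List A} {x} → last xs ≡ just x → x ∈ xs
  last⇒∈ {_ ∷ []}     refl = here refl
  last⇒∈ {_ ∷ y ∷ xs} eq   = there (last⇒∈ {y ∷ xs} eq)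

  last∈tail : ∀ {x y z} {xs : List A} → last (x ∷ xs) ≡ just y → z ∈ xs → y ∈ xs
  last∈tail {xs = _ ∷ _} eq _ = last⇒∈ eq

  enters : ∀ {xs : List A} {x} y → x ∈ xs → ∃[ p ] Step p x (y ∷ xs)
  enters y (here refl)  = y , here (refl ∷ refl ∷ [])
  enters y (there x∈xs) = map₂ there (enters _ x∈xs)

  arrives : ∀ {xs : List A} {x y} → x ∈ xs → head xs ≡ just y → x ≢ y → ∃[ p ] Step p x xs
  arrives (here refl)  refl x≢y = contradiction refl x≢y
  arrives (there x∈xs) _    _   = enters _ x∈xs

  leaves : ∀ {xs : List A} {x z} → x ∈ xs → last xs ≡ just z → x ≢ z → ∃[ y ] Step x y xs
  leaves {_ ∷ []}     (here refl) refl x≢z = contradiction refl x≢z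
  leaves {_ ∷ y ∷ xs} (here refl) _    _   = y , here (refl ∷ refl ∷ [])
  leaves {_ ∷ y ∷ xs} (there x∈)  eq   x≢z = map₂ there (leaves x∈ eq x≢z)

  length-mono-⊆ : ∀ {xs ys : List A} → Unique xs → xs ⊆ ys → length xs ℕ.≤ length ys
  length-mono-⊆ []                       _     = z≤n
  length-mono-⊆ {x ∷ xs} (x∉xs ∷ unique) xs⊆ys
    with ys₁ , ys₂ , refl ← ∈-∃++ (xs⊆ys (here refl)) = begin
      ℕ.suc (length xs)                  ≤⟨ s≤s (length-mono-⊆ unique xs⊆ys₁++ys₂) ⟩
      ℕ.suc (length (ys₁ ++ ys₂))        ≡⟨ cong ℕ.suc (length-++ ys₁) ⟩
      ℕ.suc (length ys₁ ℕ.+ length ys₂)  ≡⟨ sym (ℕ.+-suc (length ys₁) (length ys₂)) ⟩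
      length ys₁ ℕ.+ ℕ.suc (length ys₂)  ≡⟨ sym (length-++ ys₁) ⟩
      length (ys₁ ++ x ∷ ys₂)            ∎
    where
    open ℕ.≤-Reasoning
    xs⊆ys₁++ys₂ : xs ⊆ ys₁ ++ ys₂
    xs⊆ys₁++ys₂ {y} y∈xs with ∈-++⁻ ys₁ (xs⊆ys (there y∈xs))
    ... | inj₁ y∈ys₁         = ∈-++⁺ˡ y∈ys₁
    ... | inj₂ (here refl)   = contradiction y∈xs (All¬⇒¬Any x∉xs)
    ... | inj₂ (there y∈ys₂) = ∈-++⁺ʳ ys₁ y∈ys₂

Weight : ℕ → Set
Weight n = Fin n → Fin n → ℚ

cost-+ : ∀ (f g : Weight n) W → cost (λ p q → f p q + g p q) W ≡ cost f W + cost g W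
cost-+ f g []          = sym (+-identityʳ 0ℚ)
cost-+ f g (_ ∷ [])    = sym (+-identityʳ 0ℚ)
cost-+ f g (p ∷ q ∷ W) =
  trans (cong (f p q + g p q +_) (cost-+ f g (q ∷ W)))
        (interchange (f p q) (g p q) (cost f (q ∷ W)) (cost g (q ∷ W)))

cost-* : ∀ c (f : Weight n) W → cost (λ p q → c * f p q) W ≡ c * cost f W
cost-* c f []          = sym (*-zeroʳ c)
cost-* c f (_ ∷ [])    = sym (*-zeroʳ c)
cost-* c f (p ∷ q ∷ W) =
  trans (cong (c * f p q +_) (cost-* c f (q ∷ W))) (sym (*-distribˡ-+ c (f p q) (cost f (q ∷ W))))

cost-∑ : ∀ {m} (F : Fin m → Weight n) W →
         cost (λ p q → ∑[ x < m ] F x p q) W ≡ ∑[ x < m ] cost (F x) W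
cost-∑ {m = m} F []       = sym (sum-replicate-zero m)
cost-∑ {m = m} F (_ ∷ []) = sym (sum-replicate-zero m)
cost-∑ F (p ∷ q ∷ W) =
  trans (cong (∑[ x < _ ] F x p q +_) (cost-∑ F (q ∷ W)))
        (sym (∑-distrib-+ (λ x → F x p q) (λ x → cost (F x) (q ∷ W))))

cost-∷ʳ : ∀ (f : Weight n) {v} W x → last W ≡ just v → cost f (W ∷ʳ x) ≡ cost f W + f v x
cost-∷ʳ f (y ∷ [])    x refl = trans (+-identityʳ (f y x)) (sym (+-identityˡ (f y x)))
cost-∷ʳ f (y ∷ z ∷ W) x eq   =
  trans (cong (f y z +_) (cost-∷ʳ f (z ∷ W) x eq)) (sym (+-assoc (f y z) _ _))

cost-mono : ∀ {R : Fin n → Fin n → Set} {f g : Weight n} →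
            (∀ {p q} → R p q → f p q ≤ g p q) → ∀ {W} → Linked R W → cost f W ≤ cost g W
cost-mono f≤g []       = ≤-refl
cost-mono f≤g [-]      = ≤-refl
cost-mono f≤g (r ∷ rs) = +-mono-≤ (f≤g r) (cost-mono f≤g rs)

cost-nonneg : ∀ {f : Weight n} → (∀ p q → 0ℚ ≤ f p q) → ∀ W → 0ℚ ≤ cost f W
cost-nonneg f≥0 []          = ≤-refl
cost-nonneg f≥0 (_ ∷ [])    = ≤-refl
cost-nonneg f≥0 (p ∷ q ∷ W) = +-mono-≤ (f≥0 p q) (cost-nonneg f≥0 (q ∷ W))

step≤cost : ∀ {f : Weight n} → (∀ p q → 0ℚ ≤ f p q) → ∀ {p q W} → Step p q W → f p q ≤ cost f W
step≤cost f≥0 {W = _ ∷ q ∷ W} (here (refl ∷ refl ∷ [])) = x≤x+y (cost-nonneg f≥0 (q ∷ W))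
step≤cost f≥0 {W = _ ∷ []}    (there (here ()))
step≤cost f≥0 {W = y ∷ z ∷ W} (there step)              =
  ≤-trans (step≤cost f≥0 step) (≤-trans (≤-reflexive (sym (+-identityˡ _))) (+-monoˡ-≤ _ (f≥0 y z)))

∑-mono-≤ : ∀ {m} {f g : Fin m → ℚ} → (∀ i → f i ≤ g i) → ∑[ i < m ] f i ≤ ∑[ i < m ] g i
∑-mono-≤ {ℕ.zero}  f≤g = ≤-refl
∑-mono-≤ {ℕ.suc m} f≤g = +-mono-≤ (f≤g zero) (∑-mono-≤ (f≤g ∘ suc))

_↦_ : Fin n → ℚ → Fin n → ℚ
(p ↦ c) x = if does (x ≟ p) then c else 0ℚ

∑-↦ : ∀ {m} (p : Fin m) c → ∑[ x < m ] (p ↦ c) x ≡ c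
∑-↦ {ℕ.suc m} zero    c = trans (cong (c +_) (sum-replicate-zero m)) (+-identityʳ c)
∑-↦ {ℕ.suc m} (suc p) c = trans (+-identityˡ _) (∑-↦ p c)

↦-self : ∀ (p : Fin n) c → (p ↦ c) p ≡ c
↦-self p c with p ≟ p
... | yes _   = refl
... | no p≢p = contradiction refl p≢p

↦-nonneg : ∀ {p : Fin n} {c} → 0ℚ ≤ c → ∀ x → 0ℚ ≤ (p ↦ c) x
↦-nonneg {p = p} 0≤c x with x ≟ p
... | yes _ = 0≤c
... | no _  = ≤-refl

-- The greedy behaviour of the algorithm

module Greedy {n} (α : ℚ) (s t : Fin n) (w : Weight n)
  (1≤α : 1ℚ ≤ α) (α<2 : α < 2ℚ)
  (w-bounds : ∀ i j → i ≢ j → 1ℚ ≤ w i j × w i j ≤ α) where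

  open GEEWE α s t w
  open import Data.List.Membership.DecPropositional (_≟_ {n}) using (_∈?_; _∉?_)

  visited?≡∈? : ∀ h u → visited? h u ≡ does (u ∈? h)
  visited?≡∈? []      u = refl
  visited?≡∈? (x ∷ h) u with x ≟ u | u ≟ x
  ... | yes _    | yes _    = refl
  ... | yes refl | no u≢u   = contradiction refl u≢u
  ... | no x≢u   | yes refl = contradiction refl x≢u
  ... | no _     | no _     = visited?≡∈? h u

  estimate-visited : ∀ {h i} j → i ∈ h → estimate h i j ≡ w i j
  estimate-visited {h} {i} j i∈h rewrite visited?≡∈? h i | dec-true (i ∈? h) i∈h = refl

  estimate-unvisited : ∀ {h i j} → i ∉ h → j ∉ h → estimate h i j ≡ α
  estimate-unvisited {h} {i} {j} i∉h j∉h
    rewrite visited?≡∈? h i | visited?≡∈? h j | dec-false (i ∈? h) i∉h | dec-false (j ∈? h) j∉h = refl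

  estimate-bounds : ∀ h {i j} → i ≢ j → 1ℚ ≤ estimate h i j × estimate h i j ≤ α
  estimate-bounds h {i} {j} i≢j with visited? h i ∨ visited? h j
  ... | true  = w-bounds i j i≢j
  ... | false = 1≤α , ≤-refl

  visited≢unvisited : ∀ {h : List (Fin n)} {u v} → v ∈ h → u ∉ h → v ≢ u
  visited≢unvisited v∈h u∉h refl = u∉h v∈h

  α-1<1 : α - 1ℚ < 1ℚ
  α-1<1 = +-mono-<-≤ α<2 (≤-refl { - 1ℚ})

  unvisited : List (Fin n) → List (Fin n) → List (Fin n)
  unvisited h = filter (_∉? h)

  -- penalty is a potential: a step r → r′ costs at least entry h r′ plus the increase of
  -- penalty (step-potential); for a step from an unvisited to a visited vertex this is α - 1 ≤ 1.

  penalty : List (Fin n) → Fin n → ℚ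
  penalty h r = if does (r ∈? h) then α - 1ℚ else 0ℚ

  entry : List (Fin n) → Fin n → ℚ
  entry h r = if does (r ∈? h) then 0ℚ else α

  penalty-nonneg : ∀ h r → 0ℚ ≤ penalty h r
  penalty-nonneg h r with r ∈? h
  ... | yes _ = p≤q⇒0≤q-p 1≤α
  ... | no _  = ≤-refl

  penalty≤α-1 : ∀ h r → penalty h r ≤ α - 1ℚ
  penalty≤α-1 h r with r ∈? h
  ... | yes _ = ≤-refl
  ... | no _  = p≤q⇒0≤q-p 1≤α

  penalty-unvisited : ∀ {h r} → r ∉ h → penalty h r ≡ 0ℚ
  penalty-unvisited {h} {r} r∉h rewrite dec-false (r ∈? h) r∉h = refl

  unvisited-∷ : ∀ h r R → length (unvisited h (r ∷ R)) times α ≡ entry h r + length (unvisited h R) times α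
  unvisited-∷ h r R with r ∈? h
  ... | yes _ = sym (+-identityˡ _)
  ... | no _  = refl

  step-potential : ∀ h {r r′} → r ≢ r′ → entry h r′ + penalty h r′ ≤ estimate h r r′ + penalty h r
  step-potential h {r} {r′} r≢r′ with r ∈? h | r′ ∈? h | estimate-bounds h r≢r′
  ... | yes _   | yes _    | 1≤e , _ = +-monoˡ-≤ (α - 1ℚ) (≤-trans 0≤1 1≤e)
  ... | yes _   | no _     | 1≤e , _ = begin
    α + 0ℚ                        ≡⟨ solve 1 (λ α → α :+ con 0ℚ := con 1ℚ :+ (α :- con 1ℚ)) refl α ⟩
    1ℚ + (α - 1ℚ)                 ≤⟨ +-monoˡ-≤ (α - 1ℚ) 1≤e ⟩
    estimate h r r′ + (α - 1ℚ)    ∎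
    where
    open ≤-Reasoning
    open +-*-Solver
  ... | no _    | yes _    | 1≤e , _ = begin
    0ℚ + (α - 1ℚ)                 ≡⟨ +-identityˡ (α - 1ℚ) ⟩
    α - 1ℚ                        ≤⟨ <⇒≤ α-1<1 ⟩
    1ℚ                            ≤⟨ 1≤e ⟩
    estimate h r r′               ≡⟨ sym (+-identityʳ _) ⟩
    estimate h r r′ + 0ℚ          ∎
    where
    open ≤-Reasoning
  ... | no r∉h  | no r′∉h  | _       = ≤-reflexive (cong (_+ 0ℚ) (sym (estimate-unvisited r∉h r′∉h)))

  unvisited-entries : ∀ h {r R} → Linked _≢_ (r ∷ R) →
                      length (unvisited h R) times α ≤ cost (estimate h) (r ∷ R) + penalty h r
  unvisited-entries h {r} [-] = ≤-trans (penalty-nonneg h r) (≤-reflexive (sym (+-identityˡ _)))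
  unvisited-entries h {r} {r′ ∷ R} (r≢r′ ∷ walk) = begin
    length (unvisited h (r′ ∷ R)) times α        ≡⟨ unvisited-∷ h r′ R ⟩
    entry h r′ + length (unvisited h R) times α  ≤⟨ +-monoʳ-≤ (entry h r′) (unvisited-entries h walk) ⟩
    entry h r′ + (c + penalty h r′)              ≡⟨ solve 3 (λ a c p → a :+ (c :+ p) := (a :+ p) :+ c) refl
                                                          (entry h r′) c (penalty h r′) ⟩
    (entry h r′ + penalty h r′) + c              ≤⟨ +-monoˡ-≤ c (step-potential h r≢r′) ⟩
    (estimate h r r′ + penalty h r) + c          ≡⟨ solve 3 (λ e p c → (e :+ p) :+ c := (e :+ c) :+ p) refl
                                                          (estimate h r r′) (penalty h r) c ⟩
    (estimate h r r′ + c) + penalty h r          ∎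
    where
    c = cost (estimate h) (r′ ∷ R)
    open ≤-Reasoning
    open +-*-Solver

  record Tour (h E : List (Fin n)) : Set where
    field
      unique      : Unique E
      ⊆-unvisited : ∀ {u} → u ∈ E → u ∉ h
      ⊇-unvisited : ∀ {u} → u ∉ h → u ∈ E
      ends        : last E ≡ just t

  tour-plan : ∀ {h v E} → v ∈ h → Tour h E → IsPlan h v (v ∷ E)
  tour-plan {E = []}    _   T = contradiction (Tour.ends T) λ ()
  tour-plan {E = e ∷ E} v∈h T =
    (refl , ends , visited≢unvisited v∈h (⊆-unvisited (here refl)) ∷ AllPairs⇒Linked unique) ,
    λ _ u∉h → there (⊇-unvisited u∉h)
    where
    open Tour T

  cost-unvisited : ∀ {h e E} → (∀ {u} → u ∈ e ∷ E → u ∉ h) →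
                   cost (estimate h) (e ∷ E) ≡ length E times α
  cost-unvisited {E = []}    _   = refl
  cost-unvisited {E = _ ∷ _} unv =
    cong₂ _+_ (estimate-unvisited (unv (here refl)) (unv (there (here refl)))) (cost-unvisited (unv ∘ there))

  tour-cost : ∀ {h v e E} → v ∈ h → Tour h (e ∷ E) →
              cost (estimate h) (v ∷ e ∷ E) ≡ w v e + length E times α
  tour-cost {e = e} v∈h T = cong₂ _+_ (estimate-visited e v∈h) (cost-unvisited (Tour.⊆-unvisited T))

  tour-cost-≤ : ∀ {h v E} → v ∈ h → Tour h E → cost (estimate h) (v ∷ E) ≤ length E times α
  tour-cost-≤ {E = []}        _   T = contradiction (Tour.ends T) λ ()
  tour-cost-≤ {h} {v} {e ∷ E} v∈h T = begin
    cost (estimate h) (v ∷ e ∷ E)  ≡⟨ tour-cost v∈h T ⟩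
    w v e + length E times α       ≤⟨ +-monoˡ-≤ (length E times α) (proj₂ (w-bounds v e v≢e)) ⟩
    α + length E times α           ∎
    where
    open ≤-Reasoning
    v≢e = visited≢unvisited v∈h (Tour.⊆-unvisited T (here refl))

  unvisited-outside : List (Fin n) → List (Fin n) → List (Fin n)
  unvisited-outside h D = filter (λ u → u ∉? h ×-dec u ∉? D) (allFin n)

  ∈-unvisited-outside : ∀ {h D u} → u ∉ h → u ∉ D → u ∈ unvisited-outside h D
  ∈-unvisited-outside {h} {D} {u} u∉h u∉D =
    ∈-filter⁺ (λ u → u ∉? h ×-dec u ∉? D) (∈-allFin u) (u∉h , u∉D)

  unvisited-outside-∉ : ∀ {h D u} → u ∈ unvisited-outside h D → u ∉ h × u ∉ D
  unvisited-outside-∉ {h} {D} u∈ = proj₂ (∈-filter⁻ (λ u → u ∉? h ×-dec u ∉? D) {xs = allFin n} u∈)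

  route : List (Fin n) → List (Fin n) → List (Fin n)
  route h D = unvisited-outside h D ∷ʳ t

  module _ {h} (t∉h : t ∉ h) where

    route-unique : ∀ {D} → t ∈ D → Unique (route h D)
    route-unique {D} t∈D =
      ++⁺ (filter⁺ (λ u → u ∉? h ×-dec u ∉? D) (allFin⁺ n)) ([] ∷ [])
          (λ { (u∈ , here refl) → proj₂ (unvisited-outside-∉ u∈) t∈D })

    route-unvisited : ∀ {D u} → u ∈ route h D → u ∉ h
    route-unvisited {D} u∈ with ∈-++⁻ (unvisited-outside h D) u∈
    ... | inj₁ u∈outside   = proj₁ (unvisited-outside-∉ u∈outside)
    ... | inj₂ (here refl) = t∉h

    tour : Tour h (route h (t ∷ []))
    tour = record
      { unique      = route-unique (here refl)
      ; ⊆-unvisited = route-unvisited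
      ; ⊇-unvisited = complete
      ; ends        = last-∷ʳ (unvisited-outside h (t ∷ [])) t
      }
      where
      complete : ∀ {u} → u ∉ h → u ∈ route h (t ∷ [])
      complete {u} u∉h with u ≟ t
      ... | yes refl = ∈-++⁺ʳ (unvisited-outside h (t ∷ [])) (here refl)
      ... | no u≢t   = ∈-++⁺ˡ (∈-unvisited-outside u∉h (∉-∷ u≢t λ ()))

    tour-via : ∀ {y} → y ∉ h → y ≢ t → Tour h (y ∷ route h (y ∷ t ∷ []))
    tour-via {y} y∉h y≢t = record
      { unique      = ¬Any⇒All¬ _ y∉route ∷ route-unique (there (here refl))
      ; ⊆-unvisited = λ { (here refl) → y∉h ; (there u∈) → route-unvisited u∈ }
      ; ⊇-unvisited = complete
      ; ends        = last-∷ʳ (y ∷ unvisited-outside h (y ∷ t ∷ [])) t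
      }
      where
      y∉route : y ∉ route h (y ∷ t ∷ [])
      y∉route y∈ with ∈-++⁻ (unvisited-outside h (y ∷ t ∷ [])) y∈
      ... | inj₁ y∈outside  = proj₂ (unvisited-outside-∉ y∈outside) (here refl)
      ... | inj₂ (here y≡t) = y≢t y≡t
      complete : ∀ {u} → u ∉ h → u ∈ y ∷ route h (y ∷ t ∷ [])
      complete {u} u∉h with u ≟ y | u ≟ t
      ... | yes refl | _        = here refl
      ... | no _     | yes refl = there (∈-++⁺ʳ (unvisited-outside h (y ∷ t ∷ [])) (here refl))
      ... | no u≢y   | no u≢t   =
        there (∈-++⁺ˡ (∈-unvisited-outside u∉h (∉-∷ u≢y (∉-∷ u≢t λ ()))))

  module FirstStep {h v x rest} (v∈h : v ∈ h) (t∉h : t ∉ h)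
                   (shortest : IsShortestPlan h v (v ∷ x ∷ rest)) where

    private
      ends : last (x ∷ rest) ≡ just t
      ends = proj₁ (proj₂ (proj₁ (proj₁ shortest)))

      linked : Linked _≢_ (v ∷ x ∷ rest)
      linked = proj₂ (proj₂ (proj₁ (proj₁ shortest)))

      cheapest : ∀ {Q} → IsPlan h v Q → cost (estimate h) (v ∷ x ∷ rest) ≤ cost (estimate h) Q
      cheapest = proj₂ shortest _

      reached : ∀ {u} → u ∉ h → u ∈ x ∷ rest
      reached u∉h with proj₂ (proj₁ shortest) _ u∉h
      ... | here refl = contradiction v∈h u∉h
      ... | there u∈  = u∈

      later : ∀ {u} → u ∉ h → u ≢ x → u ∈ rest
      later u∉h u≢x with reached u∉h
      ... | here u≡x = contradiction u≡x u≢x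
      ... | there u∈ = u∈

    -- Otherwise the first step is a wasted detour: the plan costs at least 2 - α more than
    -- a tour through the unvisited vertices.

    rest-misses-unvisited : ¬ (∀ {u} → u ∉ h → u ∈ rest)
    rest-misses-unvisited covered = <-irrefl refl (≤-<-trans 1≤α-1 α-1<1)
      where
      T = tour t∉h
      K = length (route h (t ∷ [])) times α
      c = cost (estimate h) (x ∷ rest)
      e = estimate h v x
      K≤N : K ≤ length (unvisited h rest) times α
      K≤N = times-monoˡ-≤ (≤-trans 0≤1 1≤α) (length-mono-⊆ (Tour.unique T)
              λ u∈ → ∈-filter⁺ (_∉? h) (covered (Tour.⊆-unvisited T u∈)) (Tour.⊆-unvisited T u∈))
      1≤α-1 : 1ℚ ≤ α - 1ℚ
      1≤α-1 = +-cancelʳ-≤ K (begin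
        1ℚ + K
          ≤⟨ +-mono-≤ (proj₁ (estimate-bounds h (Linked.head linked))) K≤N ⟩
        e + length (unvisited h rest) times α
          ≤⟨ +-monoʳ-≤ e (≤-trans (unvisited-entries h (Linked.tail linked)) (+-monoʳ-≤ c (penalty≤α-1 h x))) ⟩
        e + (c + (α - 1ℚ))
          ≡⟨ solve 3 (λ e c b → e :+ (c :+ b) := b :+ (e :+ c)) refl e c (α - 1ℚ) ⟩
        (α - 1ℚ) + (e + c)
          ≤⟨ +-monoʳ-≤ (α - 1ℚ) (≤-trans (cheapest (tour-plan v∈h T)) (tour-cost-≤ v∈h T)) ⟩
        (α - 1ℚ) + K ∎)
        where
        open ≤-Reasoning
        open +-*-Solver

    first-step-unvisited : x ∉ h
    first-step-unvisited x∈h =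
      rest-misses-unvisited λ u∉h → later u∉h (visited≢unvisited x∈h u∉h ∘ sym)

    first-step-end : x ≡ t → ∀ {u} → u ∉ h → u ≡ t
    first-step-end x≡t {u} u∉h with u ≟ t
    ... | yes u≡t = u≡t
    ... | no u≢t  = ⊥-elim (rest-misses-unvisited covered)
      where
      covered : ∀ {z} → z ∉ h → z ∈ rest
      covered {z} z∉h with z ≟ t
      ... | yes refl = last∈tail ends (later u∉h λ u≡x → u≢t (trans u≡x x≡t))
      ... | no z≢t   = later z∉h λ z≡x → z≢t (trans z≡x x≡t)

    first-step-nearest : ∀ {y} → y ∉ h → y ≢ t → w v x ≤ w v y
    first-step-nearest {y} y∉h y≢t = +-cancelʳ-≤ L (begin
      w v x + L                         ≤⟨ +-monoʳ-≤ (w v x) L≤c ⟩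
      w v x + c                         ≡⟨ cong (_+ c) (sym (estimate-visited x v∈h)) ⟩
      cost (estimate h) (v ∷ x ∷ rest)  ≤⟨ cheapest (tour-plan v∈h T) ⟩
      cost (estimate h) (v ∷ y ∷ F)     ≡⟨ tour-cost v∈h T ⟩
      w v y + L                         ∎)
      where
      open ≤-Reasoning
      F = route h (y ∷ t ∷ [])
      T = tour-via t∉h y∉h y≢t
      L = length F times α
      c = cost (estimate h) (x ∷ rest)
      |F|≤N : length F ℕ.≤ length (unvisited h rest)
      |F|≤N = ℕ.≤-pred (subst (λ xs → ℕ.suc (length F) ℕ.≤ length xs)
                              (filter-accept (_∉? h) first-step-unvisited)
                              (length-mono-⊆ (Tour.unique T) λ u∈ →
                                 ∈-filter⁺ (_∉? h) (reached (Tour.⊆-unvisited T u∈)) (Tour.⊆-unvisited T u∈)))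
      L≤c : L ≤ c
      L≤c = begin
        L                                  ≤⟨ times-monoˡ-≤ (≤-trans 0≤1 1≤α) |F|≤N ⟩
        length (unvisited h rest) times α  ≤⟨ unvisited-entries h (Linked.tail linked) ⟩
        c + penalty h x                    ≡⟨ cong (c +_) (penalty-unvisited first-step-unvisited) ⟩
        c + 0ℚ                             ≡⟨ +-identityʳ c ⟩
        c                                  ∎

-- The charging scheme

-- leg x is the weight of the edge by which the run left x, and Assigned x y means that, when
-- the run left x, y was either still unvisited and different from t, or the next vertex.

record Charging {n} (α : ℚ) (s t : Fin n) (w : Weight n) : Set₁ where
  field
    Departed           : Fin n → Set
    departed?          : ∀ x → Dec (Departed x)
    leg                : Fin n → ℚ
    Assigned           : Fin n → Fin n → Set
    assigned?          : ∀ x y → Dec (Assigned x y)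
    leg-undeparted     : ∀ {x} → ¬ Departed x → leg x ≡ 0ℚ
    leg-bounds         : ∀ {x} → Departed x → 1ℚ ≤ leg x × leg x ≤ α
    leg-assigned       : ∀ {x y} → Assigned x y → leg x ≤ w x y
    assigned-departed  : ∀ {x y} → Assigned x y → Departed x
    assigned-asym      : ∀ {x y} → Assigned x y → ¬ Assigned y x
    assigned-total     : ∀ {x y} → Departed x → Departed y → x ≢ y → Assigned x y ⊎ Assigned y x
    start-assigned     : Departed s → ∀ {y} → y ≢ s → y ≢ t → Assigned s y
    start-assigned-end : Departed s → (∀ u → u ≡ s ⊎ u ≡ t) → Assigned s t
    end-undeparted     : ¬ Departed t

module ChargingBound {n} {α : ℚ} {s t : Fin n} {w : Weight n} (C : Charging α s t w)
  (1≤α : 1ℚ ≤ α) (α≤3 : α ≤ 3ℚ)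
  (w-sym : ∀ i j → w i j ≡ w j i) (w≥1 : ∀ i j → i ≢ j → 1ℚ ≤ w i j) where

  open Charging C
  open GEEWE α s t w using (IsExplorationWalk)

  surcharge : Fin n → Fin n → ℚ
  surcharge x y = if does (assigned? x y) then 2ℚ * (leg x - 1ℚ) else α - 1ℚ

  departure-charge arrival-charge : Fin n → Fin n → ℚ
  departure-charge p q = if does (departed? p) then 2ℚ + surcharge p q else 0ℚ
  arrival-charge   p q = if does (departed? q) then surcharge q p else 0ℚ

  -- W may never enter s; instead s is charged at a step leaving t, which exists unless s
  -- was left for t directly. Such a step may also carry an arrival charge, whence α ≤ 3.

  return-charge : Fin n → ℚ
  return-charge p = if does (p ≟ t) ∧ does (departed? s) then α - 1ℚ else 0ℚ

  departures arrivals returns charge : Fin n → Weight n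
  departures x p q = (p ↦ departure-charge p q) x
  arrivals   x p q = (q ↦ arrival-charge p q) x
  returns    x p q = (s ↦ return-charge p) x
  charge     x p q = departures x p q + arrivals x p q + returns x p q

  excess : Weight n
  excess p q = 2ℚ * (w p q - 1ℚ)

  budget : Weight n
  budget p q = (2ℚ + excess p q) + (α - 1ℚ)

  surcharge-assigned : ∀ {x y} → Assigned x y → surcharge x y ≡ 2ℚ * (leg x - 1ℚ)
  surcharge-assigned {x} {y} a rewrite dec-true (assigned? x y) a = refl

  surcharge-unassigned : ∀ {x y} → ¬ Assigned x y → surcharge x y ≡ α - 1ℚ
  surcharge-unassigned {x} {y} ¬a rewrite dec-false (assigned? x y) ¬a = refl

  surcharge-nonneg : ∀ {x} → Departed x → ∀ y → 0ℚ ≤ surcharge x y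
  surcharge-nonneg {x} dx y with assigned? x y
  ... | yes _ = *-monoˡ-≤-nonNeg 2ℚ (p≤q⇒0≤q-p (proj₁ (leg-bounds dx)))
  ... | no _  = p≤q⇒0≤q-p 1≤α

  surcharge≤excess : ∀ {x y} → Assigned x y → surcharge x y ≤ excess x y
  surcharge≤excess a = ≤-trans (≤-reflexive (surcharge-assigned a))
                               (*-monoˡ-≤-nonNeg 2ℚ (+-monoˡ-≤ (- 1ℚ) (leg-assigned a)))

  excess-nonneg : ∀ {p q} → p ≢ q → 0ℚ ≤ excess p q
  excess-nonneg {p} {q} p≢q = *-monoˡ-≤-nonNeg 2ℚ (p≤q⇒0≤q-p (w≥1 p q p≢q))

  departure-charge-departed : ∀ {p} → Departed p → ∀ q → departure-charge p q ≡ 2ℚ + surcharge p q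
  departure-charge-departed {p} dp q rewrite dec-true (departed? p) dp = refl

  departure-charge-undeparted : ∀ {p} → ¬ Departed p → ∀ q → departure-charge p q ≡ 0ℚ
  departure-charge-undeparted {p} ¬dp q rewrite dec-false (departed? p) ¬dp = refl

  arrival-charge-departed : ∀ {q} → Departed q → ∀ p → arrival-charge p q ≡ surcharge q p
  arrival-charge-departed {q} dq p rewrite dec-true (departed? q) dq = refl

  arrival-charge-undeparted : ∀ {q} → ¬ Departed q → ∀ p → arrival-charge p q ≡ 0ℚ
  arrival-charge-undeparted {q} ¬dq p rewrite dec-false (departed? q) ¬dq = refl

  return-charge-start : Departed s → return-charge t ≡ α - 1ℚ
  return-charge-start ds rewrite dec-true (t ≟ t) refl | dec-true (departed? s) ds = refl

  return-charge-departed : ∀ {p} → Departed p → return-charge p ≡ 0ℚ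
  return-charge-departed {p} dp rewrite dec-false (p ≟ t) λ { refl → end-undeparted dp } = refl

  departure-charge-nonneg : ∀ p q → 0ℚ ≤ departure-charge p q
  departure-charge-nonneg p q with departed? p
  ... | yes dp = +-mono-≤ 0≤2 (surcharge-nonneg dp q)
  ... | no _   = ≤-refl

  arrival-charge-nonneg : ∀ p q → 0ℚ ≤ arrival-charge p q
  arrival-charge-nonneg p q with departed? q
  ... | yes dq = surcharge-nonneg dq p
  ... | no _   = ≤-refl

  return-charge-nonneg : ∀ p → 0ℚ ≤ return-charge p
  return-charge-nonneg p with does (p ≟ t) ∧ does (departed? s)
  ... | true  = p≤q⇒0≤q-p 1≤α
  ... | false = ≤-refl

  return-charge≤ : ∀ p → return-charge p ≤ α - 1ℚ
  return-charge≤ p with does (p ≟ t) ∧ does (departed? s)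
  ... | true  = ≤-refl
  ... | false = p≤q⇒0≤q-p 1≤α

  arrival-charge≤excess : ∀ {p q} → p ≢ q → (Departed q → Assigned q p) → arrival-charge p q ≤ excess p q
  arrival-charge≤excess {p} {q} p≢q assigned with toSum (departed? q)
  ... | inj₁ dq = begin
    arrival-charge p q   ≡⟨ arrival-charge-departed dq p ⟩
    surcharge q p        ≤⟨ surcharge≤excess (assigned dq) ⟩
    excess q p           ≡⟨ cong (λ c → 2ℚ * (c - 1ℚ)) (w-sym q p) ⟩
    excess p q           ∎
    where
    open ≤-Reasoning
  ... | inj₂ ¬dq = ≤-trans (≤-reflexive (arrival-charge-undeparted ¬dq p)) (excess-nonneg p≢q)

  arrival-charge≤bonus : ∀ {p q} → (Departed q → ¬ Assigned q p) → arrival-charge p q ≤ α - 1ℚ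
  arrival-charge≤bonus {p} {q} unassigned with toSum (departed? q)
  ... | inj₁ dq  = ≤-reflexive (trans (arrival-charge-departed dq p) (surcharge-unassigned (unassigned dq)))
  ... | inj₂ ¬dq = ≤-trans (≤-reflexive (arrival-charge-undeparted ¬dq p)) (p≤q⇒0≤q-p 1≤α)

  arrival-charge≤excess+bonus : ∀ {p q} → p ≢ q → arrival-charge p q ≤ excess p q + (α - 1ℚ)
  arrival-charge≤excess+bonus {p} {q} p≢q with toSum (assigned? q p)
  ... | inj₁ a  = ≤-trans (arrival-charge≤excess p≢q (λ _ → a)) (x≤x+y (p≤q⇒0≤q-p 1≤α))
  ... | inj₂ ¬a = begin
    arrival-charge p q          ≤⟨ arrival-charge≤bonus (λ _ → ¬a) ⟩
    α - 1ℚ                      ≡⟨ +-identityˡ (α - 1ℚ) ⟨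
    0ℚ + (α - 1ℚ)               ≤⟨ +-monoˡ-≤ (α - 1ℚ) (excess-nonneg p≢q) ⟩
    excess p q + (α - 1ℚ)       ∎
    where
    open ≤-Reasoning

  departed-step-charges : ∀ {p q} → Departed p → p ≢ q →
                          (2ℚ + surcharge p q) + arrival-charge p q ≤ budget p q
  departed-step-charges {p} {q} dp p≢q with toSum (assigned? p q)
  ... | inj₁ a  = +-mono-≤ (+-monoʳ-≤ 2ℚ (surcharge≤excess a)) (arrival-charge≤bonus λ _ → assigned-asym a)
  ... | inj₂ ¬a = begin
    (2ℚ + surcharge p q) + arrival-charge p q
      ≡⟨ cong (λ c → (2ℚ + c) + arrival-charge p q) (surcharge-unassigned ¬a) ⟩
    (2ℚ + (α - 1ℚ)) + arrival-charge p q
      ≤⟨ +-monoʳ-≤ (2ℚ + (α - 1ℚ)) (arrival-charge≤excess p≢q assigned) ⟩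
    (2ℚ + (α - 1ℚ)) + excess p q
      ≡⟨ solve 3 (λ a b e → (a :+ b) :+ e := (a :+ e) :+ b) refl 2ℚ (α - 1ℚ) (excess p q) ⟩
    budget p q ∎
    where
    open ≤-Reasoning
    open +-*-Solver
    assigned : Departed q → Assigned q p
    assigned dq = [ (λ a → contradiction a ¬a) , (λ a → a) ]′ (assigned-total dp dq p≢q)

  undeparted-step-charges : ∀ {p q} → ¬ Departed p → p ≢ q →
                            0ℚ + arrival-charge p q + return-charge p ≤ budget p q
  undeparted-step-charges {p} {q} ¬dp p≢q = begin
    0ℚ + arrival-charge p q + return-charge p
      ≤⟨ +-mono-≤ (+-monoʳ-≤ 0ℚ (arrival-charge≤excess+bonus p≢q)) (return-charge≤ p) ⟩
    0ℚ + (excess p q + (α - 1ℚ)) + (α - 1ℚ)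
      ≤⟨ +-monoˡ-≤ (α - 1ℚ) bonus≤2 ⟩
    budget p q ∎
    where
    open ≤-Reasoning
    open +-*-Solver
    bonus≤2 : 0ℚ + (excess p q + (α - 1ℚ)) ≤ 2ℚ + excess p q
    bonus≤2 = begin
      0ℚ + (excess p q + (α - 1ℚ))
        ≡⟨ solve 2 (λ e b → con 0ℚ :+ (e :+ b) := b :+ e) refl (excess p q) (α - 1ℚ) ⟩
      (α - 1ℚ) + excess p q
        ≤⟨ +-monoˡ-≤ (excess p q) (+-monoˡ-≤ (- 1ℚ) α≤3) ⟩
      (3ℚ - 1ℚ) + excess p q ∎

  step-charges≤budget : ∀ {p q} → p ≢ q →
                        departure-charge p q + arrival-charge p q + return-charge p ≤ budget p q
  step-charges≤budget {p} {q} p≢q with toSum (departed? p)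
  ... | inj₁ dp = begin
    departure-charge p q + arrival-charge p q + return-charge p
      ≡⟨ cong₂ _+_ (cong (_+ arrival-charge p q) (departure-charge-departed dp q)) (return-charge-departed dp) ⟩
    (2ℚ + surcharge p q) + arrival-charge p q + 0ℚ
      ≡⟨ +-identityʳ _ ⟩
    (2ℚ + surcharge p q) + arrival-charge p q
      ≤⟨ departed-step-charges dp p≢q ⟩
    budget p q ∎
    where
    open ≤-Reasoning
  ... | inj₂ ¬dp = begin
    departure-charge p q + arrival-charge p q + return-charge p
      ≡⟨ cong (λ c → c + arrival-charge p q + return-charge p) (departure-charge-undeparted ¬dp q) ⟩
    0ℚ + arrival-charge p q + return-charge p
      ≤⟨ undeparted-step-charges ¬dp p≢q ⟩
    budget p q ∎
    where
    open ≤-Reasoning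

  budget≤weight : ∀ {p q} → p ≢ q → budget p q ≤ (α + 1ℚ) * w p q
  budget≤weight {p} {q} p≢q = begin
    budget p q
      ≤⟨ x≤x+y (*-nonneg (p≤q⇒0≤q-p 1≤α) (p≤q⇒0≤q-p (w≥1 p q p≢q))) ⟩
    budget p q + (α - 1ℚ) * (w p q - 1ℚ)
      ≡⟨ solve 2 (λ α w → (con 2ℚ :+ con 2ℚ :* (w :- con 1ℚ)) :+ (α :- con 1ℚ) :+ (α :- con 1ℚ) :* (w :- con 1ℚ)
                          := (α :+ con 1ℚ) :* w) refl α (w p q) ⟩
    (α + 1ℚ) * w p q ∎
    where
    open ≤-Reasoning
    open +-*-Solver

  ∑-charge : ∀ p q → ∑[ x < n ] charge x p q ≡ departure-charge p q + arrival-charge p q + return-charge p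
  ∑-charge p q = begin
    ∑[ x < n ] charge x p q
      ≡⟨ ∑-distrib-+ (λ x → departures x p q + arrivals x p q) (λ x → returns x p q) ⟩
    ∑[ x < n ] (departures x p q + arrivals x p q) + ∑[ x < n ] returns x p q
      ≡⟨ cong (_+ ∑[ x < n ] returns x p q) (∑-distrib-+ (λ x → departures x p q) (λ x → arrivals x p q)) ⟩
    ∑[ x < n ] departures x p q + ∑[ x < n ] arrivals x p q + ∑[ x < n ] returns x p q
      ≡⟨ cong₂ _+_ (cong₂ _+_ (∑-↦ p _) (∑-↦ q _)) (∑-↦ s _) ⟩
    departure-charge p q + arrival-charge p q + return-charge p ∎
    where
    open ≡-Reasoning

  leg≤assigned : ∀ {x y} → Assigned x y → 2ℚ * leg x ≤ 2ℚ + surcharge x y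
  leg≤assigned {x} {y} a = ≤-reflexive (begin
    2ℚ * leg x
      ≡⟨ solve 1 (λ l → con 2ℚ :* l := con 2ℚ :+ con 2ℚ :* (l :- con 1ℚ)) refl (leg x) ⟩
    2ℚ + 2ℚ * (leg x - 1ℚ)
      ≡⟨ cong (2ℚ +_) (sym (surcharge-assigned a)) ⟩
    2ℚ + surcharge x y ∎)
    where
    open ≡-Reasoning
    open +-*-Solver

  leg≤surcharges : ∀ {x} → Departed x → ∀ y z → 2ℚ * leg x ≤ (2ℚ + surcharge x y) + surcharge x z
  leg≤surcharges {x} dx y z with toSum (assigned? x y) | toSum (assigned? x z)
  ... | inj₁ a  | _      = ≤-trans (leg≤assigned a) (x≤x+y (surcharge-nonneg dx z))
  ... | inj₂ _  | inj₁ a = begin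
    2ℚ * leg x                            ≤⟨ leg≤assigned a ⟩
    2ℚ + surcharge x z                    ≤⟨ +-monoˡ-≤ (surcharge x z) (x≤x+y {2ℚ} (surcharge-nonneg dx y)) ⟩
    (2ℚ + surcharge x y) + surcharge x z  ∎
    where
    open ≤-Reasoning
  ... | inj₂ ¬a | inj₂ ¬b = begin
    2ℚ * leg x
      ≤⟨ *-monoˡ-≤-nonNeg 2ℚ (proj₂ (leg-bounds dx)) ⟩
    2ℚ * α
      ≡⟨ solve 1 (λ α → con 2ℚ :* α := (con 2ℚ :+ (α :- con 1ℚ)) :+ (α :- con 1ℚ)) refl α ⟩
    (2ℚ + (α - 1ℚ)) + (α - 1ℚ)
      ≡⟨ cong₂ (λ a b → (2ℚ + a) + b) (surcharge-unassigned ¬a) (surcharge-unassigned ¬b) ⟨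
    (2ℚ + surcharge x y) + surcharge x z ∎
    where
    open ≤-Reasoning
    open +-*-Solver

  cost-charge : ∀ x W → cost (departures x) W + cost (arrivals x) W + cost (returns x) W ≡ cost (charge x) W
  cost-charge x W = sym (trans (cost-+ (λ p q → departures x p q + arrivals x p q) (returns x) W)
                               (cong (_+ cost (returns x) W) (cost-+ (departures x) (arrivals x) W)))

  charge-nonneg : ∀ x p q → 0ℚ ≤ charge x p q
  charge-nonneg x p q = +-mono-≤ (+-mono-≤ (↦-nonneg (departure-charge-nonneg p q) x)
                                           (↦-nonneg (arrival-charge-nonneg p q) x))
                                 (↦-nonneg (return-charge-nonneg p) x)

  arrivals-nonneg : ∀ x W → 0ℚ ≤ cost (arrivals x) W
  arrivals-nonneg x = cost-nonneg λ p q → ↦-nonneg (arrival-charge-nonneg p q) x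

  returns-nonneg : ∀ x W → 0ℚ ≤ cost (returns x) W
  returns-nonneg x = cost-nonneg λ p q → ↦-nonneg (return-charge-nonneg p) x

  departure≤ : ∀ {x y W} → Step x y W → departure-charge x y ≤ cost (departures x) W
  departure≤ {x} {y} step = ≤-trans (≤-reflexive (sym (↦-self x (departure-charge x y))))
    (step≤cost (λ p q → ↦-nonneg (departure-charge-nonneg p q) x) step)

  arrival≤ : ∀ {p x W} → Step p x W → arrival-charge p x ≤ cost (arrivals x) W
  arrival≤ {p} {x} step = ≤-trans (≤-reflexive (sym (↦-self x (arrival-charge p x))))
    (step≤cost (λ p q → ↦-nonneg (arrival-charge-nonneg p q) x) step)

  return≤ : ∀ {z W} → Step t z W → return-charge t ≤ cost (returns s) W
  return≤ step = ≤-trans (≤-reflexive (sym (↦-self s (return-charge t))))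
    (step≤cost (λ p q → ↦-nonneg (return-charge-nonneg p) s) step)

  departed-covered : ∀ {W x} → IsExplorationWalk W → Departed x → x ≢ s → 2ℚ * leg x ≤ cost (charge x) W
  departed-covered {W} {x} ((starts , ends , _) , covers) dx x≢s
    with y , exit  ← leaves (covers x) ends (λ { refl → end-undeparted dx })
       | p , entry ← arrives (covers x) starts x≢s = begin
    2ℚ * leg x                                   ≤⟨ leg≤surcharges dx y p ⟩
    (2ℚ + surcharge x y) + surcharge x p         ≡⟨ sym (cong₂ _+_ (departure-charge-departed dx y)
                                                                  (arrival-charge-departed dx p)) ⟩
    departure-charge x y + arrival-charge p x    ≤⟨ +-mono-≤ (departure≤ exit) (arrival≤ entry) ⟩
    cost (departures x) W + cost (arrivals x) W  ≤⟨ x≤x+y (returns-nonneg x W) ⟩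
    cost (departures x) W + cost (arrivals x) W + cost (returns x) W
                                                 ≡⟨ cost-charge x W ⟩
    cost (charge x) W                            ∎
    where
    open ≤-Reasoning

  start-covered : ∀ {W} → IsExplorationWalk W → Departed s → 2ℚ * leg s ≤ cost (charge s) W
  start-covered {[]}        ((() , _) , _)  _
  start-covered {_ ∷ []}    ((refl , refl , _) , _) ds = contradiction ds end-undeparted
  start-covered {_ ∷ y ∷ W} ((refl , ends , s≢y ∷ _) , covers) ds with toSum (assigned? s y)
  ... | inj₁ a = begin
    2ℚ * leg s                                     ≤⟨ leg≤assigned a ⟩
    2ℚ + surcharge s y                             ≡⟨ sym (departure-charge-departed ds y) ⟩
    departure-charge s y                           ≤⟨ departure≤ {W = W′} (here (refl ∷ refl ∷ [])) ⟩
    cost (departures s) W′                         ≤⟨ x≤x+y (arrivals-nonneg s W′) ⟩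
    cost (departures s) W′ + cost (arrivals s) W′  ≤⟨ x≤x+y (returns-nonneg s W′) ⟩
    cost (departures s) W′ + cost (arrivals s) W′ + cost (returns s) W′
                                                   ≡⟨ cost-charge s W′ ⟩
    cost (charge s) W′                             ∎
    where
    open ≤-Reasoning
    W′ = s ∷ y ∷ W
  ... | inj₂ ¬a with toSum (y ≟ t)
  ...   | inj₂ y≢t = contradiction (start-assigned ds (s≢y ∘ sym) y≢t) ¬a
  ...   | inj₁ refl with W
  ...     | []     = contradiction (start-assigned-end ds only-s-t) ¬a
    where
    only-s-t : ∀ u → u ≡ s ⊎ u ≡ t
    only-s-t u with covers u
    ... | here u≡s         = inj₁ u≡s
    ... | there (here u≡t) = inj₂ u≡t
  ...     | z ∷ W″ = begin
    2ℚ * leg s                                     ≤⟨ leg≤surcharges ds t t ⟩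
    (2ℚ + surcharge s t) + surcharge s t           ≡⟨ cong₂ _+_ (sym (departure-charge-departed ds t))
                                                       (trans (surcharge-unassigned ¬a) (sym (return-charge-start ds))) ⟩
    departure-charge s t + return-charge t         ≤⟨ +-mono-≤ (departure≤ {W = W′} (here (refl ∷ refl ∷ [])))
                                                               (return≤ {W = W′} (there (here (refl ∷ refl ∷ [])))) ⟩
    cost (departures s) W′ + cost (returns s) W′   ≤⟨ +-monoˡ-≤ _ (x≤x+y {cost (departures s) W′} (arrivals-nonneg s W′)) ⟩
    cost (departures s) W′ + cost (arrivals s) W′ + cost (returns s) W′
                                                   ≡⟨ cost-charge s W′ ⟩
    cost (charge s) W′                             ∎
    where
    open ≤-Reasoning
    W′ = s ∷ t ∷ z ∷ W″

  charge-covers-leg : ∀ {W} → IsExplorationWalk W → ∀ x → 2ℚ * leg x ≤ cost (charge x) W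
  charge-covers-leg {W} explores x with toSum (departed? x)
  ... | inj₂ ¬dx = begin
    2ℚ * leg x         ≡⟨ cong (2ℚ *_) (leg-undeparted ¬dx) ⟩
    2ℚ * 0ℚ            ≡⟨ *-zeroʳ 2ℚ ⟩
    0ℚ                 ≤⟨ cost-nonneg (charge-nonneg x) W ⟩
    cost (charge x) W  ∎
    where
    open ≤-Reasoning
  ... | inj₁ dx with toSum (x ≟ s)
  ...   | inj₁ refl = start-covered explores dx
  ...   | inj₂ x≢s  = departed-covered explores dx x≢s

  charging-bound : ∀ {W} → IsExplorationWalk W → 2ℚ * ∑[ x < n ] leg x ≤ (α + 1ℚ) * cost w W
  charging-bound {W} explores = begin
    2ℚ * ∑[ x < n ] leg x                      ≡⟨ *-distribˡ-sum 2ℚ leg ⟩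
    ∑[ x < n ] (2ℚ * leg x)                    ≤⟨ ∑-mono-≤ (charge-covers-leg explores) ⟩
    ∑[ x < n ] cost (charge x) W               ≡⟨ sym (cost-∑ charge W) ⟩
    cost (λ p q → ∑[ x < n ] charge x p q) W   ≤⟨ cost-mono step-bound (proj₂ (proj₂ (proj₁ explores))) ⟩
    cost (λ p q → (α + 1ℚ) * w p q) W          ≡⟨ cost-* (α + 1ℚ) w W ⟩
    (α + 1ℚ) * cost w W                        ∎
    where
    open ≤-Reasoning
    step-bound : ∀ {p q} → p ≢ q → ∑[ x < n ] charge x p q ≤ (α + 1ℚ) * w p q
    step-bound p≢q = ≤-trans (≤-reflexive (∑-charge _ _))
                             (≤-trans (step-charges≤budget p≢q) (budget≤weight p≢q))

-- Runs of the algorithm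

module Runs {n} (α : ℚ) (s t : Fin n) (w : Weight n)
  (1≤α : 1ℚ ≤ α) (α<2 : α < 2ℚ) (s≢t : s ≢ t)
  (w-bounds : ∀ i j → i ≢ j → 1ℚ ≤ w i j × w i j ≤ α) where

  open GEEWE α s t w
  open Greedy α s t w 1≤α α<2 w-bounds using (module FirstStep; visited≢unvisited)
  open import Data.List.Membership.DecPropositional (_≟_ {n}) using (_∈?_)

  module _ (C : Charging α s t w) where
    open Charging C

    record Consistent (v : Fin n) (h : List (Fin n)) : Set where
      field
        cost≡∑leg          : cost w h ≡ ∑[ x < n ] leg x
        last-current       : last h ≡ just v
        departed⇒visited   : ∀ {u} → Departed u → u ∈ h
        visited⇒departed   : ∀ {u} → u ∈ h → Departed u ⊎ u ≡ v
        current-undeparted : ¬ Departed v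
        current-end        : v ≡ t → ∀ u → u ∈ h
        assigned-fresh     : ∀ {x y} → Departed x → ¬ Departed y → y ≢ t → Assigned x y
        start-status       : Departed s ⊎ (s ≡ v × ∀ u → ¬ Departed u)

  Invariant : Fin n → List (Fin n) → Set₁
  Invariant v h = Σ (Charging α s t w) λ C → Consistent C v h

  initial : Invariant s (s ∷ [])
  initial = C₀ , record
    { cost≡∑leg          = sym (sum-replicate-zero n)
    ; last-current       = refl
    ; departed⇒visited   = λ ()
    ; visited⇒departed   = λ { (here u≡s) → inj₂ u≡s }
    ; current-undeparted = λ ()
    ; current-end        = λ s≡t → contradiction s≡t s≢t
    ; assigned-fresh     = λ ()
    ; start-status       = inj₂ (refl , λ _ ())
    }
    where
    C₀ : Charging α s t w
    C₀ = record
      { Departed           = λ _ → ⊥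
      ; departed?          = λ _ → no λ ()
      ; leg                = λ _ → 0ℚ
      ; Assigned           = λ _ _ → ⊥
      ; assigned?          = λ _ _ → no λ ()
      ; leg-undeparted     = λ _ → refl
      ; leg-bounds         = λ ()
      ; leg-assigned       = λ ()
      ; assigned-departed  = λ ()
      ; assigned-asym      = λ ()
      ; assigned-total     = λ ()
      ; start-assigned     = λ ()
      ; start-assigned-end = λ ()
      ; end-undeparted     = λ ()
      }

  module Move {C v h} (I : Consistent C v h) (unfinished : ¬ Finished v h)
              {x rest} (shortest : IsShortestPlan h v (v ∷ x ∷ rest)) where
    open Charging C
    open Consistent I

    v∈h : v ∈ h
    v∈h = last⇒∈ last-current

    v≢t : v ≢ t
    v≢t v≡t = unfinished (current-end v≡t , v≡t)

    t∉h : t ∉ h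
    t∉h t∈h with visited⇒departed t∈h
    ... | inj₁ dt  = end-undeparted dt
    ... | inj₂ t≡v = v≢t (sym t≡v)

    open FirstStep v∈h t∉h shortest

    v≢x : v ≢ x
    v≢x = visited≢unvisited v∈h first-step-unvisited

    Departed′ : Fin n → Set
    Departed′ u = Departed u ⊎ u ≡ v

    undeparted⇒unvisited : ∀ {u} → ¬ Departed′ u → u ∉ h
    undeparted⇒unvisited ¬du u∈h with visited⇒departed u∈h
    ... | inj₁ du  = ¬du (inj₁ du)
    ... | inj₂ u≡v = ¬du (inj₂ u≡v)

    leg′ : Fin n → ℚ
    leg′ u = leg u + (v ↦ w v x) u

    leg′-departed : ∀ {u} → Departed u → leg′ u ≡ leg u
    leg′-departed {u} du rewrite dec-false (u ≟ v) (λ { refl → current-undeparted du }) = +-identityʳ (leg u)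

    leg′-current : leg′ v ≡ w v x
    leg′-current rewrite leg-undeparted current-undeparted | ↦-self v (w v x) = +-identityˡ (w v x)

    Candidate : Fin n → Set
    Candidate y = y ∉ h × y ≢ t ⊎ y ≡ x

    candidate-unvisited : ∀ {y} → Candidate y → y ∉ h
    candidate-unvisited (inj₁ (y∉h , _)) = y∉h
    candidate-unvisited (inj₂ refl)      = first-step-unvisited

    assigned⇒visited : ∀ {u y} → Assigned u y → u ∈ h
    assigned⇒visited = departed⇒visited ∘ assigned-departed

    Assigned′ : Fin n → Fin n → Set
    Assigned′ u y = Assigned u y ⊎ (u ≡ v × Candidate y)

    leg′-undeparted : ∀ {u} → ¬ Departed′ u → leg′ u ≡ 0ℚ
    leg′-undeparted {u} ¬du
      rewrite leg-undeparted (¬du ∘ inj₁) | dec-false (u ≟ v) (¬du ∘ inj₂) = +-identityˡ 0ℚ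

    leg′-bounds : ∀ {u} → Departed′ u → 1ℚ ≤ leg′ u × leg′ u ≤ α
    leg′-bounds (inj₁ du)   rewrite leg′-departed du = leg-bounds du
    leg′-bounds (inj₂ refl) rewrite leg′-current     = w-bounds v x v≢x

    leg′-assigned : ∀ {u y} → Assigned′ u y → leg′ u ≤ w u y
    leg′-assigned (inj₁ a) rewrite leg′-departed (assigned-departed a) = leg-assigned a
    leg′-assigned (inj₂ (refl , inj₁ (y∉h , y≢t))) rewrite leg′-current = first-step-nearest y∉h y≢t
    leg′-assigned (inj₂ (refl , inj₂ refl))         rewrite leg′-current = ≤-refl

    assigned′-asym : ∀ {u y} → Assigned′ u y → ¬ Assigned′ y u
    assigned′-asym (inj₁ a)          (inj₁ b)          = assigned-asym a b
    assigned′-asym (inj₁ a)          (inj₂ (refl , c)) = candidate-unvisited c (assigned⇒visited a)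
    assigned′-asym (inj₂ (refl , c)) (inj₁ b)          = candidate-unvisited c (assigned⇒visited b)
    assigned′-asym (inj₂ (refl , c)) (inj₂ (refl , _)) = candidate-unvisited c v∈h

    assigned′-total : ∀ {u y} → Departed′ u → Departed′ y → u ≢ y → Assigned′ u y ⊎ Assigned′ y u
    assigned′-total (inj₁ du)   (inj₁ dy)   u≢y = Data.Sum.map inj₁ inj₁ (assigned-total du dy u≢y)
    assigned′-total (inj₁ du)   (inj₂ refl) _   = inj₁ (inj₁ (assigned-fresh du current-undeparted v≢t))
    assigned′-total (inj₂ refl) (inj₁ dy)   _   = inj₂ (inj₁ (assigned-fresh dy current-undeparted v≢t))
    assigned′-total (inj₂ refl) (inj₂ refl) u≢y = contradiction refl u≢y

    start-assigned′ : Departed′ s → ∀ {y} → y ≢ s → y ≢ t → Assigned′ s y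
    start-assigned′ _ {y} y≢s y≢t with start-status
    ... | inj₁ ds               = inj₁ (start-assigned ds y≢s y≢t)
    ... | inj₂ (refl , nothing) = inj₂ (refl , inj₁ (y∉h , y≢t))
      where
      y∉h : y ∉ h
      y∉h y∈h with visited⇒departed y∈h
      ... | inj₁ dy  = nothing y dy
      ... | inj₂ y≡s = y≢s y≡s

    start-assigned-end′ : Departed′ s → (∀ u → u ≡ s ⊎ u ≡ t) → Assigned′ s t
    start-assigned-end′ _ only with start-status | only x
    ... | inj₁ ds         | _        = inj₁ (start-assigned-end ds only)
    ... | inj₂ (refl , _) | inj₁ x≡v = contradiction (sym x≡v) v≢x
    ... | inj₂ (refl , _) | inj₂ x≡t = inj₂ (refl , inj₂ (sym x≡t))

    charging′ : Charging α s t w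
    charging′ = record
      { Departed           = Departed′
      ; departed?          = λ u → departed? u ⊎-dec (u ≟ v)
      ; leg                = leg′
      ; Assigned           = Assigned′
      ; assigned?          = λ u y → assigned? u y ⊎-dec
                                       ((u ≟ v) ×-dec ((¬? (y ∈? h) ×-dec ¬? (y ≟ t)) ⊎-dec (y ≟ x)))
      ; leg-undeparted     = leg′-undeparted
      ; leg-bounds         = leg′-bounds
      ; leg-assigned       = leg′-assigned
      ; assigned-departed  = [ inj₁ ∘ assigned-departed , inj₂ ∘ proj₁ ]′
      ; assigned-asym      = assigned′-asym
      ; assigned-total     = assigned′-total
      ; start-assigned     = start-assigned′
      ; start-assigned-end = start-assigned-end′
      ; end-undeparted     = [ end-undeparted , v≢t ∘ sym ]′
      }

    cost≡∑leg′ : cost w (h ∷ʳ x) ≡ ∑[ u < n ] leg′ u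
    cost≡∑leg′ = begin
      cost w (h ∷ʳ x)                               ≡⟨ cost-∷ʳ w h x last-current ⟩
      cost w h + w v x                              ≡⟨ cong₂ _+_ cost≡∑leg (sym (∑-↦ v (w v x))) ⟩
      ∑[ u < n ] leg u + ∑[ u < n ] (v ↦ w v x) u   ≡⟨ sym (∑-distrib-+ leg (v ↦ w v x)) ⟩
      ∑[ u < n ] leg′ u                             ∎
      where
      open ≡-Reasoning

    departed′⇒visited : ∀ {u} → Departed′ u → u ∈ h ∷ʳ x
    departed′⇒visited (inj₁ du)   = ∈-++⁺ˡ (departed⇒visited du)
    departed′⇒visited (inj₂ refl) = ∈-++⁺ˡ v∈h

    visited⇒departed′ : ∀ {u} → u ∈ h ∷ʳ x → Departed′ u ⊎ u ≡ x
    visited⇒departed′ u∈ with ∈-++⁻ h u∈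
    ... | inj₁ u∈h        = inj₁ (visited⇒departed u∈h)
    ... | inj₂ (here u≡x) = inj₂ u≡x

    current-end′ : x ≡ t → ∀ u → u ∈ h ∷ʳ x
    current-end′ x≡t u with u ∈? h
    ... | yes u∈h = ∈-++⁺ˡ u∈h
    ... | no u∉h  = ∈-++⁺ʳ h (here (trans (first-step-end x≡t u∉h) (sym x≡t)))

    assigned′-fresh : ∀ {u y} → Departed′ u → ¬ Departed′ y → y ≢ t → Assigned′ u y
    assigned′-fresh (inj₁ du)   ¬dy y≢t = inj₁ (assigned-fresh du (¬dy ∘ inj₁) y≢t)
    assigned′-fresh (inj₂ refl) ¬dy y≢t = inj₂ (refl , inj₁ (undeparted⇒unvisited ¬dy , y≢t))

    consistent′ : Consistent charging′ x (h ∷ʳ x)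
    consistent′ = record
      { cost≡∑leg          = cost≡∑leg′
      ; last-current       = last-∷ʳ h x
      ; departed⇒visited   = departed′⇒visited
      ; visited⇒departed   = visited⇒departed′
      ; current-undeparted = [ first-step-unvisited ∘ departed⇒visited , v≢x ∘ sym ]′
      ; current-end        = current-end′
      ; assigned-fresh     = assigned′-fresh
      ; start-status       = inj₁ ([ inj₁ , inj₂ ∘ proj₁ ]′ start-status)
      }

  run-invariant : ∀ {v h} → Run v h → Invariant v h
  run-invariant start = initial
  run-invariant (step run unfinished x rest shortest) =
    let I = proj₂ (run-invariant run) in
    Move.charging′ I unfinished shortest , Move.consistent′ I unfinished shortest

corollary1 : (α : ℚ) → 1ℚ ≤ α → α < 1ℚ + 1ℚ →
    (n : ℕ) (s t : Fin n) → s ≢ t →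
    (w : Fin n → Fin n → ℚ) →
    (∀ i j → w i j ≡ w j i) →
    (∀ i j → i ≢ j → 1ℚ ≤ w i j × w i j ≤ α) →
    ∀ v h → GEEWE.Run α s t w v h →
    ∀ W → GEEWE.IsExplorationWalk α s t w W →
    cost w h ≤ ((α + 1ℚ) * ½) * cost w W
corollary1 α 1≤α α<2 n s t s≢t w w-sym w-bounds v h run W explores = halve {c = α + 1ℚ} (begin
  2ℚ * cost w h          ≡⟨ cong (2ℚ *_) (Consistent.cost≡∑leg I) ⟩
  2ℚ * ∑[ x < n ] leg x  ≤⟨ charging-bound explores ⟩
  (α + 1ℚ) * cost w W    ∎)
  where
  open ≤-Reasoning
  open Runs α s t w 1≤α α<2 s≢t w-bounds using (Invariant; run-invariant; module Consistent)
  invariant : Invariant v h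
  invariant = run-invariant run
  C = proj₁ invariant
  I = proj₂ invariant
  α≤3 : α ≤ 3ℚ
  α≤3 = ≤-trans (<⇒≤ α<2) (x≤x+y 0≤1)
  w≥1 : ∀ i j → i ≢ j → 1ℚ ≤ w i j
  w≥1 i j i≢j = proj₁ (w-bounds i j i≢j)
  open Charging C using (leg)
  open ChargingBound C 1≤α α≤3 w-sym w≥1 using (charging-bound)
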